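{- For every $\chi \in 2^{\mathbb{Z}}$, define $\theta_\chi \colon 2\mathbb{Z} \times 2 \to (2\mathbb{Z}+1) \times 2$ by $\theta_\chi(n,i) = (n+1,\ 1 - \chi(n+1))$ if $i = \chi(n)$, and $\theta_\chi(n,i) = (n-1,\ \chi(n-1))$ if $i \neq \chi(n)$. Then for all $g \in D_\infty$, $\chi \in 2^{\mathbb{Z}}$ and $x \in 2\mathbb{Z} \times 2$, we have $\theta_{g \cdot \chi}(g \cdot x) = g \cdot \theta_\chi(x)$.
   Context: Here $2 = \{0,1\}$ and $2^{\mathbb{Z}}$ is the set of functions $\mathbb{Z} \to \{0,1\}$. $D_\infty = \langle t, r \mid r^2 = 1,\ r t r = t^{ -1}\rangle$ is the infinite dihedral group, acting on $\mathbb{Z}$ by $t \cdot n = n+2$ and $r \cdot n = -n$ (which restricts to $2\mathbb{Z}$ and $2\mathbb{Z}+1$), on $2^{\mathbb{Z}}$ by $(t\cdot\chi)(n) = \chi(n-2)$ and $(r \cdot \chi)(n) = 1 - \chi(-n)$, trivially on $2$, and diagonally on $2\mathbb{Z} \times 2$ and $(2\mathbb{Z}+1)\times 2$. -}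

module Defs where

open import Data.Bool using (Bool; not; if_then_else_)
open import Data.Bool.Properties using () renaming (_≟_ to _≟ᵇ_)
open import Data.Integer using (ℤ; _+_; _-_; -_; +_)
open import Data.List using (List; []; _∷_)
open import Data.Product using (_×_; _,_)
open import Relation.Nullary using (yes; no)

-- 2 = {0,1} is rendered as Bool (false = 0, true = 1); "1 - b" is 'not b'.
Two : Set
Two = Bool

Chi : Set
Chi = ℤ → Two

-- Generators of D∞ = ⟨ t , r ∣ r² = 1 , r t r = t⁻¹ ⟩ (and t⁻¹; r⁻¹ = r).
data Gen : Set where
  t t⁻¹ r : Gen

-- An element of D∞ is given by a word in the generators (every element
-- is such a word); the action of a word is the composite of the
-- generator actions (leftmost letter acts last).
D∞ : Set
D∞ = List Gen

genℤ : Gen → ℤ → ℤ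
genℤ t   n = n + + 2
genℤ t⁻¹ n = n - + 2
genℤ r   n = - n

actℤ : D∞ → ℤ → ℤ
actℤ []      n = n
actℤ (g ∷ w) n = genℤ g (actℤ w n)

genχ : Gen → Chi → Chi
genχ t   χ n = χ (n - + 2)
genχ t⁻¹ χ n = χ (n + + 2)
genχ r   χ n = not (χ (- n))

actχ : D∞ → Chi → Chi
actχ []      χ = χ
actχ (g ∷ w) χ = genχ g (actχ w χ)

actP : D∞ → ℤ × Two → ℤ × Two
actP w (n , i) = (actℤ w n , i)

θ : Chi → ℤ × Two → ℤ × Two
θ χ (n , i) with i ≟ᵇ χ n
... | yes _ = (n + + 1 , not (χ (n + + 1)))
... | no  _ = (n - + 1 , χ (n - + 1))

module Submission where

-- The map θ_χ only looks at χ near n and moves n by one step: to n + 1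
-- when i agrees with χ(n), to n - 1 otherwise.  Hence it is natural with
-- respect to any relabelling σ of ℤ that carries unit steps to unit steps:
--   * if σ preserves steps (σ(m ± 1) = σ m ± 1) and χ' ∘ σ = χ, then
--     θ_χ'(σ n, i) = (σ × id)(θ_χ(n, i))                 (θ-natural-shift);
--   * if σ reverses steps (σ(m ± 1) = σ m ∓ 1) and χ' ∘ σ = 1 - χ, the
--     same holds: reversing the direction and complementing χ cancel out,
--     because "i agrees with χ(n)" turns into "i disagrees with χ'(σ n)"
--                                                          (θ-natural-flip).
-- The generators t, t⁻¹ of D∞ are step-preserving translations and r is
-- the step-reversing reflection, so θ commutes with every generator, and
-- by induction on words with every element of D∞.  The equivariance holds
-- on all of ℤ × 2.

open import Defs
open import Data.Integer using (ℤ; +_; _+_; _-_; -_)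
open import Data.Integer.Divisibility using (_∣_)
open import Data.Integer.Tactic.RingSolver using (solve-∀)
open import Data.Product using (_,_; map₁)
open import Data.Bool using (not)
open import Data.Bool.Properties using (not-involutive; not-¬; ¬-not) renaming (_≟_ to _≟ᵇ_)
open import Data.List using ([]; _∷_)
open import Relation.Binary.PropositionalEquality
open import Relation.Nullary using (yes; no; ¬_; contradiction)

θ-agree : ∀ χ n i → i ≡ χ n → θ χ (n , i) ≡ (n + + 1 , not (χ (n + + 1)))
θ-agree χ n i i≡χn with i ≟ᵇ χ n
... | yes _    = refl
... | no  i≢χn = contradiction i≡χn i≢χn

θ-disagree : ∀ χ n i → ¬ (i ≡ χ n) → θ χ (n , i) ≡ (n - + 1 , χ (n - + 1))
θ-disagree χ n i i≢χn with i ≟ᵇ χ n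
... | yes i≡χn = contradiction i≡χn i≢χn
... | no  _    = refl

θ-natural-shift : (σ : ℤ → ℤ) (χ χ' : Chi) →
  (∀ m → σ (m + + 1) ≡ σ m + + 1) → (∀ m → σ (m - + 1) ≡ σ m - + 1) →
  (∀ m → χ' (σ m) ≡ χ m) →
  ∀ n i → θ χ' (σ n , i) ≡ map₁ σ (θ χ (n , i))
θ-natural-shift σ χ χ' up down χ'σ n i with i ≟ᵇ χ n
... | yes i≡χn = begin
  θ χ' (σ n , i)                          ≡⟨ θ-agree χ' (σ n) i (trans i≡χn (sym (χ'σ n))) ⟩
  (σ n + + 1 , not (χ' (σ n + + 1)))      ≡⟨ cong (λ m → m , not (χ' m)) (sym (up n)) ⟩
  (σ (n + + 1) , not (χ' (σ (n + + 1))))  ≡⟨ cong (λ b → σ (n + + 1) , not b) (χ'σ (n + + 1)) ⟩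
  (σ (n + + 1) , not (χ (n + + 1)))       ∎
  where open ≡-Reasoning
... | no i≢χn = begin
  θ χ' (σ n , i)                          ≡⟨ θ-disagree χ' (σ n) i (λ i≡ → i≢χn (trans i≡ (χ'σ n))) ⟩
  (σ n - + 1 , χ' (σ n - + 1))            ≡⟨ cong (λ m → m , χ' m) (sym (down n)) ⟩
  (σ (n - + 1) , χ' (σ (n - + 1)))        ≡⟨ cong (σ (n - + 1) ,_) (χ'σ (n - + 1)) ⟩
  (σ (n - + 1) , χ (n - + 1))             ∎
  where open ≡-Reasoning

θ-natural-flip : (σ : ℤ → ℤ) (χ χ' : Chi) →
  (∀ m → σ (m + + 1) ≡ σ m - + 1) → (∀ m → σ (m - + 1) ≡ σ m + + 1) →
  (∀ m → χ' (σ m) ≡ not (χ m)) →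
  ∀ n i → θ χ' (σ n , i) ≡ map₁ σ (θ χ (n , i))
θ-natural-flip σ χ χ' up down χ'σ n i with i ≟ᵇ χ n
... | yes i≡χn = begin
  θ χ' (σ n , i)                          ≡⟨ θ-disagree χ' (σ n) i (λ i≡ → not-¬ i≡χn (trans i≡ (χ'σ n))) ⟩
  (σ n - + 1 , χ' (σ n - + 1))            ≡⟨ cong (λ m → m , χ' m) (sym (up n)) ⟩
  (σ (n + + 1) , χ' (σ (n + + 1)))        ≡⟨ cong (σ (n + + 1) ,_) (χ'σ (n + + 1)) ⟩
  (σ (n + + 1) , not (χ (n + + 1)))       ∎
  where open ≡-Reasoning
... | no i≢χn = begin
  θ χ' (σ n , i)                          ≡⟨ θ-agree χ' (σ n) i (trans (¬-not i≢χn) (sym (χ'σ n))) ⟩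
  (σ n + + 1 , not (χ' (σ n + + 1)))      ≡⟨ cong (λ m → m , not (χ' m)) (sym (down n)) ⟩
  (σ (n - + 1) , not (χ' (σ (n - + 1))))  ≡⟨ cong (λ b → σ (n - + 1) , not b) (χ'σ (n - + 1)) ⟩
  (σ (n - + 1) , not (not (χ (n - + 1)))) ≡⟨ cong (σ (n - + 1) ,_) (not-involutive _) ⟩
  (σ (n - + 1) , χ (n - + 1))             ∎
  where open ≡-Reasoning

step-t : ∀ m → m + + 1 + + 2 ≡ m + + 2 + + 1
step-t = solve-∀

step⁻-t : ∀ m → m - + 1 + + 2 ≡ m + + 2 - + 1
step⁻-t = solve-∀

step-t⁻¹ : ∀ m → m + + 1 - + 2 ≡ m - + 2 + + 1
step-t⁻¹ = solve-∀

step⁻-t⁻¹ : ∀ m → m - + 1 - + 2 ≡ m - + 2 - + 1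
step⁻-t⁻¹ = solve-∀

step-r : ∀ m → - (m + + 1) ≡ - m - + 1
step-r = solve-∀

step⁻-r : ∀ m → - (m - + 1) ≡ - m + + 1
step⁻-r = solve-∀

undo-t : ∀ m → m + + 2 - + 2 ≡ m
undo-t = solve-∀

undo-t⁻¹ : ∀ m → m - + 2 + + 2 ≡ m
undo-t⁻¹ = solve-∀

undo-r : ∀ m → - - m ≡ m
undo-r = solve-∀

θ-equivariant-gen : ∀ g χ n i →
  θ (genχ g χ) (genℤ g n , i) ≡ map₁ (genℤ g) (θ χ (n , i))
θ-equivariant-gen t   χ = θ-natural-shift (genℤ t) χ (genχ t χ) step-t step⁻-t
                            (λ m → cong χ (undo-t m))
θ-equivariant-gen t⁻¹ χ = θ-natural-shift (genℤ t⁻¹) χ (genχ t⁻¹ χ) step-t⁻¹ step⁻-t⁻¹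
                            (λ m → cong χ (undo-t⁻¹ m))
θ-equivariant-gen r   χ = θ-natural-flip (genℤ r) χ (genχ r χ) step-r step⁻-r
                            (λ m → cong (λ k → not (χ k)) (undo-r m))

θ-equivariant : ∀ g χ n i → θ (actχ g χ) (actP g (n , i)) ≡ actP g (θ χ (n , i))
θ-equivariant []      χ n i = refl
θ-equivariant (g ∷ w) χ n i = begin
  θ (genχ g (actχ w χ)) (genℤ g (actℤ w n) , i)  ≡⟨ θ-equivariant-gen g (actχ w χ) (actℤ w n) i ⟩
  map₁ (genℤ g) (θ (actχ w χ) (actP w (n , i)))  ≡⟨ cong (map₁ (genℤ g)) (θ-equivariant w χ n i) ⟩
  map₁ (genℤ g) (actP w (θ χ (n , i)))           ∎
  where open ≡-Reasoning

lemma3p2 : (g : D∞) (χ : Chi) (n : ℤ) (i : Two) → + 2 ∣ n →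
    θ (actχ g χ) (actP g (n , i)) ≡ actP g (θ χ (n , i))
lemma3p2 g χ n i _ = θ-equivariant g χ n i
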